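{- Let $X=\{x,y,z\}$, $N=\{1,\dots,n\}$ with $n\ge 3$, and let $g:NP\to X$ be strategy-proof with $\mathrm{Range}(g|NP^{*})=\{x\}$. If $u\in NP$ and at least one individual in $\{1,2,\dots,n-2\}$ has $x$ ranked at the top of his ordering at $u$, then $g(u)=x$.
   Context: A profile is a map $p:N\to L(X)$, where $L(X)$ is the set of strict linear orderings of $X$; write $a\succ_{p(i)}b$ if individual $i$ strictly prefers $a$ to $b$ at $p$. $NP$ is the set of all profiles $p$ such that for every pair of distinct alternatives $a,b$ there exist individuals $i,j$ with $a\succ_{p(i)}b$ and $b\succ_{p(j)}a$. $NP^{*}$ is the set of profiles $u\in NP$ with $u(n-1)=u(n)$. Two profiles $p,q$ are $h$-variants if $q(i)=p(i)$ for all $i\neq h$. A rule $g:NP\to X$ is strategy-proof if there are no $h\in N$ and $h$-variants $p,p'\in NP$ with $g(p')\succ_{p(h)}g(p)$. -}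

module Defs where

open import Data.Nat using (ℕ; suc; _≤_; _<_)
open import Data.Fin using (Fin; zero; suc; toℕ; _<_)
open import Data.Vec using (Vec; lookup; toList)
open import Data.List.Relation.Unary.Unique.Propositional using (Unique)
open import Data.Product using (Σ; ∃; ∃-syntax; _×_; _,_; proj₁)
open import Relation.Binary.PropositionalEquality using (_≡_; _≢_)
open import Relation.Nullary using (¬_)

X : Set
X = Fin 3

x y z : X
x = zero
y = suc zero
z = suc (suc zero)

-- A strict linear ordering of X, presented as the list of the alternatives
-- from best to worst (position 0 = top), all distinct (hence every
-- alternative appears exactly once).
record LinOrd : Set where
  constructor mkLin
  field
    ranking  : Vec X 3
    distinct : Unique (toList ranking)
open LinOrd public

_≻⟨_⟩_ : X → LinOrd → X → Set
a ≻⟨ R ⟩ b = Σ (Fin 3) λ i → Σ (Fin 3) λ j →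
  (i Data.Fin.< j) × (lookup (ranking R) i ≡ a) × (lookup (ranking R) j ≡ b)

top : LinOrd → X
top R = lookup (ranking R) zero

_≈L_ : LinOrd → LinOrd → Set
R ≈L S = ranking R ≡ ranking S

-- Individuals N = {1,…,n}, encoded as Fin n with individual k ↦ index k-1.
Profile : ℕ → Set
Profile n = Fin n → LinOrd

InNP : {n : ℕ} → Profile n → Set
InNP {n} p = ∀ (a b : X) → a ≢ b →
  Σ (Fin n) λ i → Σ (Fin n) λ j → (a ≻⟨ p i ⟩ b) × (b ≻⟨ p j ⟩ a)

NP : ℕ → Set
NP n = Σ (Profile n) InNP

Variants : {n : ℕ} → Fin n → Profile n → Profile n → Set
Variants h p q = ∀ i → i ≢ h → p i ≈L q i

StrategyProof : {n : ℕ} → (NP n → X) → Set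
StrategyProof {n} g = ∀ (h : Fin n) (p p' : NP n) →
  Variants h (proj₁ p) (proj₁ p') → ¬ (g p' ≻⟨ proj₁ p h ⟩ g p)

module Submission where

-- Let individual i ≤ n-2 rank x on top at u, and let C be the
-- reversal of i's ordering, so that x is at the bottom of C.  Give C to
-- individual n, obtaining u₁, and then also to individual n-1, obtaining u₂.
-- Both profiles lie in NP, because i and n hold mutually reversed orderings
-- and therefore disagree on every pair of alternatives; u₂ lies in NP*, so
-- g(u₂) = x.  Strategy-proofness now transports the outcome x back: if the
-- outcome is at the bottom of a manipulator's true ordering, no deviation of
-- his can change it.  Applied to n-1 (true ordering C at u₂) it gives
-- g(u₁) = x, and applied to n (true ordering C at u₁) it gives g(u) = x.

open import Defs
open import Data.Nat using (ℕ; _+_; _≤_; _<_; _∸_; z≤n; s≤s)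
open import Data.Nat.Properties using (<⇒≢; m<n⇒m<1+n; n<1+n)
open import Data.Fin using (Fin; toℕ; fromℕ<; zero; suc; punchOut; _≟_)
open import Data.Fin.Properties using (toℕ-fromℕ<; any?; pigeonhole; punchOut-injective; <-cmp)
open import Data.Vec using (_∷_; []; lookup)
open import Data.Vec.Functional using (updateAt)
open import Data.Vec.Functional.Properties using (updateAt-updates; updateAt-minimal)
open import Data.List.Relation.Unary.AllPairs using ([]; _∷_)
open import Data.List.Relation.Unary.All using ([]; _∷_)
open import Data.Product using (Σ; _×_; _,_; proj₁)
open import Data.Sum using (_⊎_; inj₁; inj₂)
open import Data.Empty using (⊥; ⊥-elim)
open import Function using (const)
open import Relation.Binary.Definitions using (tri<; tri≈; tri>)
open import Relation.Nullary using (yes; no; ¬_)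
open import Relation.Binary.PropositionalEquality
  using (_≡_; _≢_; refl; sym; trans; cong; subst; ≢-sym)

ranked-above : (R : LinOrd) {i j : Fin 3} → i Data.Fin.< j →
               lookup (ranking R) i ≻⟨ R ⟩ lookup (ranking R) j
ranked-above R {i} {j} i<j = i , j , i<j , refl , refl

positions-distinct : (R : LinOrd) {i j : Fin 3} → i Data.Fin.< j →
                     lookup (ranking R) i ≢ lookup (ranking R) j
positions-distinct (mkLin (_ ∷ _ ∷ _ ∷ []) ((a≢b ∷ _ ∷ []) ∷ _)) {zero} {suc zero} _ = a≢b
positions-distinct (mkLin (_ ∷ _ ∷ _ ∷ []) ((_ ∷ a≢c ∷ []) ∷ _)) {zero} {suc (suc zero)} _ = a≢c
positions-distinct (mkLin (_ ∷ _ ∷ _ ∷ []) (_ ∷ (b≢c ∷ []) ∷ _)) {suc zero} {suc (suc zero)} _ = b≢c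
positions-distinct R {suc _} {suc zero} (s≤s ())
positions-distinct R {suc (suc _)} {suc (suc zero)} (s≤s (s≤s ()))

-- Every alternative occurs in a linear order: otherwise its three distinct
-- entries would fit into the two remaining alternatives (pigeonhole).
occurs : (R : LinOrd) (a : X) → Σ (Fin 3) λ i → lookup (ranking R) i ≡ a
occurs R a with any? (λ i → lookup (ranking R) i ≟ a)
... | yes found = found
... | no missing = ⊥-elim (collision (pigeonhole (n<1+n 2) squeeze))
  where
  avoids : ∀ i → a ≢ lookup (ranking R) i
  avoids i a≡entry = missing (i , sym a≡entry)
  squeeze : Fin 3 → Fin 2
  squeeze i = punchOut (avoids i)
  collision : (Σ (Fin 3) λ i → Σ (Fin 3) λ j →
                 (i Data.Fin.< j) × (squeeze i ≡ squeeze j)) → ⊥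
  collision (i , j , i<j , same) =
    positions-distinct R i<j (punchOut-injective (avoids i) (avoids j) same)

totality : (R : LinOrd) {a b : X} → a ≢ b → (a ≻⟨ R ⟩ b) ⊎ (b ≻⟨ R ⟩ a)
totality R {a} {b} a≢b with occurs R a | occurs R b
... | i , refl | j , refl with <-cmp i j
...   | tri< i<j _ _ = inj₁ (ranked-above R i<j)
...   | tri≈ _ refl _ = ⊥-elim (a≢b refl)
...   | tri> _ _ j<i = inj₂ (ranked-above R j<i)

top-unbeaten : (R : LinOrd) {b : X} → ¬ (b ≻⟨ R ⟩ top R)
top-unbeaten R (_ , zero , () , _)
top-unbeaten R (_ , suc j , _ , _ , entry≡top) =
  positions-distinct R {zero} {suc j} (s≤s z≤n) (sym entry≡top)

reverseOrd : LinOrd → LinOrd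
reverseOrd (mkLin (a ∷ b ∷ c ∷ []) ((a≢b ∷ a≢c ∷ []) ∷ (b≢c ∷ []) ∷ [] ∷ [])) =
  mkLin (c ∷ b ∷ a ∷ []) ((≢-sym b≢c ∷ ≢-sym a≢c ∷ []) ∷ (≢-sym a≢b ∷ []) ∷ [] ∷ [])

reverse-flips : (R : LinOrd) {a b : X} → a ≻⟨ R ⟩ b → b ≻⟨ reverseOrd R ⟩ a
reverse-flips R@(mkLin (_ ∷ _ ∷ _ ∷ []) ((_ ∷ _ ∷ []) ∷ (_ ∷ []) ∷ [] ∷ [])) = flip
  where
  flip : ∀ {a b} → a ≻⟨ R ⟩ b → b ≻⟨ reverseOrd R ⟩ a
  flip (zero , suc zero , _ , refl , refl) =
    ranked-above (reverseOrd R) {suc zero} {suc (suc zero)} (s≤s (s≤s z≤n))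
  flip (zero , suc (suc zero) , _ , refl , refl) =
    ranked-above (reverseOrd R) {zero} {suc (suc zero)} (s≤s z≤n)
  flip (suc zero , suc (suc zero) , _ , refl , refl) =
    ranked-above (reverseOrd R) {zero} {suc zero} (s≤s z≤n)
  flip (zero , zero , () , _)
  flip (suc _ , suc zero , s≤s () , _)
  flip (suc (suc _) , suc (suc zero) , s≤s (s≤s ()) , _)
  flip (suc _ , zero , () , _)

Bottom : LinOrd → X → Set
Bottom C a = ∀ b → b ≢ a → b ≻⟨ C ⟩ a

top-to-bottom : (R : LinOrd) {a : X} → top R ≡ a → Bottom (reverseOrd R) a
top-to-bottom R refl b b≢top with totality R b≢top
... | inj₁ b≻top = ⊥-elim (top-unbeaten R b≻top)
... | inj₂ top≻b = reverse-flips R top≻b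

holds-reversal : {R C : LinOrd} → C ≡ reverseOrd R → {a b : X} →
                 a ≻⟨ R ⟩ b → b ≻⟨ C ⟩ a
holds-reversal {R} refl = reverse-flips R

-- A profile in which some individual holds the reversal of another's
-- ordering lies in NP: on every pair, one of the two prefers each side.
reversed-pair-in-NP : {n : ℕ} (p : Profile n) (i k : Fin n) {R : LinOrd} →
                      p i ≡ R → p k ≡ reverseOrd R → InNP p
reversed-pair-in-NP p i k refl pk≡rev a b a≢b with totality (p i) a≢b
... | inj₁ a≻b = i , k , a≻b , holds-reversal pk≡rev a≻b
... | inj₂ b≻a = k , i , holds-reversal pk≡rev b≻a , b≻a

-- Under a strategy-proof rule, an outcome at the bottom of individual h's
-- ordering cannot be changed by h: any other outcome would be preferred.
bottom-outcome-stable : {n : ℕ} {g : NP n → X} → StrategyProof g →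
                        (h : Fin n) (p p' : NP n) → Variants h (proj₁ p) (proj₁ p') →
                        {a : X} → g p ≡ a → Bottom (proj₁ p h) a → g p' ≡ a
bottom-outcome-stable {g = g} sp h p p' variant refl bottom with g p' ≟ g p
... | yes same = same
... | no changed = ⊥-elim (sp h p p' variant (bottom (g p') changed))

update-variant : {n : ℕ} (p : Profile n) (k : Fin n) (C : LinOrd) →
                 Variants k (updateAt p k (const C)) p
update-variant p k C j j≢k = cong ranking (updateAt-minimal j k p j≢k)

below⇒≢ : {n m : ℕ} {i : Fin n} (m<n : m < n) → toℕ i < m → i ≢ fromℕ< m<n
below⇒≢ m<n i<m i≡m = <⇒≢ i<m (trans (cong toℕ i≡m) (toℕ-fromℕ< m<n))

-- The last two individuals n-1 and n of N = {1,…,m+3} have indices m+1 and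
-- m+2; they are the individuals compared in the definition of NP*.
penultimate< : (m : ℕ) → ℕ.suc m < 3 + m
penultimate< m = m<n⇒m<1+n (n<1+n (ℕ.suc m))

last< : (m : ℕ) → ℕ.suc (ℕ.suc m) < 3 + m
last< m = n<1+n (ℕ.suc (ℕ.suc m))

penultimate last : (m : ℕ) → Fin (3 + m)
penultimate m = fromℕ< (penultimate< m)
last m = fromℕ< (last< m)

penultimate≢last : (m : ℕ) → penultimate m ≢ last m
penultimate≢last m = below⇒≢ (last< m)
  (subst (_< ℕ.suc (ℕ.suc m)) (sym (toℕ-fromℕ< (penultimate< m))) (n<1+n (ℕ.suc m)))

below-penultimate : (m : ℕ) {i : Fin (3 + m)} → toℕ i < ℕ.suc m → i ≢ penultimate m
below-penultimate m = below⇒≢ (penultimate< m)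

below-last : (m : ℕ) {i : Fin (3 + m)} → toℕ i < ℕ.suc m → i ≢ last m
below-last m i<m+1 = below⇒≢ (last< m) (m<n⇒m<1+n i<m+1)

mainTheorem5 : (n : ℕ) → 3 ≤ n → (g : NP n → X) → StrategyProof g →
    (∀ (u : NP n) (lt₁ : n ∸ 2 < n) (lt₂ : n ∸ 1 < n) →
    proj₁ u (fromℕ< lt₁) ≈L proj₁ u (fromℕ< lt₂) → g u ≡ x) →
    (u : NP n) → (Σ (Fin n) λ i → (toℕ i < n ∸ 2) × (top (proj₁ u i) ≡ x)) →
    g u ≡ x
mainTheorem5 (ℕ.suc (ℕ.suc (ℕ.suc m))) _ g sp x-on-NP* u (i , i<n∸2 , x-top-of-i) =
  bottom-outcome-stable sp k₂ u₁ u (update-variant p k₂ C) x-at-u₁ (x-bottom p₁k₂)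
  where
  k₁ k₂ : Fin (3 + m)
  k₁ = penultimate m
  k₂ = last m
  p : Profile (3 + m)
  p = proj₁ u
  C : LinOrd
  C = reverseOrd (p i)
  x-bottom : ∀ {Q} → Q ≡ C → Bottom Q x
  x-bottom refl = top-to-bottom (p i) x-top-of-i
  p₁ p₂ : Profile (3 + m)
  p₁ = updateAt p k₂ (const C)
  p₂ = updateAt p₁ k₁ (const C)
  p₁k₂ : p₁ k₂ ≡ C
  p₁k₂ = updateAt-updates k₂ p
  p₂k₁ : p₂ k₁ ≡ C
  p₂k₁ = updateAt-updates k₁ p₁
  p₂k₂ : p₂ k₂ ≡ C
  p₂k₂ = trans (updateAt-minimal k₂ k₁ p₁ (≢-sym (penultimate≢last m))) p₁k₂
  p₁i : p₁ i ≡ p i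
  p₁i = updateAt-minimal i k₂ p (below-last m i<n∸2)
  p₂i : p₂ i ≡ p i
  p₂i = trans (updateAt-minimal i k₁ p₁ (below-penultimate m i<n∸2)) p₁i
  u₁ u₂ : NP (3 + m)
  u₁ = p₁ , reversed-pair-in-NP p₁ i k₂ p₁i p₁k₂
  u₂ = p₂ , reversed-pair-in-NP p₂ i k₂ p₂i p₂k₂
  x-at-u₂ : g u₂ ≡ x
  x-at-u₂ = x-on-NP* u₂ (penultimate< m) (last< m) (cong ranking (trans p₂k₁ (sym p₂k₂)))
  x-at-u₁ : g u₁ ≡ x
  x-at-u₁ = bottom-outcome-stable sp k₁ u₂ u₁ (update-variant p₁ k₁ C) x-at-u₂ (x-bottom p₂k₁)
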